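{- For every fixed $k\in\mathbb{N}$, the infinite sequence $\Bigl\{\frac{S(n+k,k)}{\binom{n+k}{k}}\Bigr\}_{n\ge0}$ is logarithmically convex in $n$; that is, for all integers $\ell\ge0$, \[ \frac{S(\ell+k+2,k)}{\binom{\ell+k+2}{k}}\cdot\frac{S(\ell+k,k)}{\binom{\ell+k}{k}}\ge\Biggl[\frac{S(\ell+k+1,k)}{\binom{\ell+k+1}{k}}\Biggr]^2. \]
   Context: $S(n,k)$ denotes the Stirling number of the second kind, i.e. the number of ways to partition an $n$-element set into $k$ nonempty subsets; equivalently $\frac{(e^x-1)^k}{k!}=\sum_{n=k}^\infty S(n,k)\frac{x^n}{n!}$ for integers $k\ge0$. -}

module Defs where

open import Data.Nat using (ℕ; zero; suc; _+_; _*_; NonZero; _>_; z<s; >-nonZero)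
open import Data.Nat.Combinatorics using (_C_; nCk+nC[k+1]≡[n+1]C[k+1])
open import Data.Nat.Properties using (+-suc; m≤m+n; <-≤-trans)
open import Data.Integer using (+_)
open import Data.Rational using (ℚ; _/_)
open import Relation.Binary.PropositionalEquality using (_≡_; refl; sym; subst)

S : ℕ → ℕ → ℕ
S zero    zero    = 1
S zero    (suc k) = 0
S (suc n) zero    = 0
S (suc n) (suc k) = suc k * S n (suc k) + S n k

binom-pos : ∀ m k → (m + k) C k > 0
binom-pos m zero = z<s
binom-pos zero (suc k) = subst (λ x → x > 0) (nCk+nC[k+1]≡[n+1]C[k+1] k k) (<-≤-trans (binom-pos zero k) (m≤m+n _ _))
binom-pos (suc m) (suc k) =
  subst (λ x → x > 0) (nCk+nC[k+1]≡[n+1]C[k+1] (m + suc k) k)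
    (<-≤-trans (subst (λ t → t C k > 0) (sym (+-suc m k)) (binom-pos (suc m) k)) (m≤m+n _ _))

ratio : ℕ → ℕ → ℚ
ratio m k = (+ S (m + k) k / ((m + k) C k)) {{>-nonZero (binom-pos m k)}}

module Submission where

-- The Stirling numbers are values of complete homogeneous symmetric
-- polynomials:  S(n+k,k) = h_n(k, k-1, ..., 1, 0).  We prove, for every list
-- xs of m naturals, the Newton-type inequality
--     (n+1)(m+n+1) h_{n+1}(xs)^2  ≤  (m+n)(n+2) h_n(xs) h_{n+2}(xs),
-- i.e. that h_n(xs) / C(m+n-1,n) is log-convex in n.  The proof is by
-- induction on n over all lists at once.  Writing the inequality as
-- b^2 ≤ a·c for a suitably normalised triple (a,b,c), the Euler identity
--     Σ_{y ∈ xs} y · h_n(y ∷ xs) = (n+1) h_{n+1}(xs)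
-- expresses the triple at n+1 for xs as a weighted sum of the triples at n
-- for the lists y ∷ xs, and "b^2 ≤ a·c" is preserved by scaling and by sums
-- (a Cauchy–Schwarz argument); the base case n = 0 is Cauchy–Schwarz itself.
-- Specialising to xs = (k, ..., 0) and using (ℓ+1) C(ℓ+k+1,k) = (ℓ+k+1) C(ℓ+k,k)
-- gives the statement by cross-multiplication of fractions.

open import Defs
open import Data.Nat using (ℕ; suc)

module CompleteHomogeneous where

  open import Data.Nat using (zero; _+_; _*_)
  open import Data.Nat.Properties using (+-comm; +-assoc; *-zeroʳ; *-identityʳ; *-distribˡ-+)
  open import Data.Nat.Tactic.RingSolver using (solve-∀)
  open import Data.List using (List; []; _∷_)
  open import Relation.Binary.PropositionalEquality
    using (_≡_; refl; sym; trans; cong; cong₂; module ≡-Reasoning)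
  open ≡-Reasoning

  -- h n xs is the sum of all monomials of degree n in the variables xs,
  -- split according to whether the first variable occurs.
  h : ℕ → List ℕ → ℕ
  h zero    xs       = 1
  h (suc n) []       = 0
  h (suc n) (x ∷ xs) = h (suc n) xs + x * h n (x ∷ xs)

  sumBy : List ℕ → (ℕ → ℕ) → ℕ
  sumBy []       f = 0
  sumBy (y ∷ ys) f = f y + sumBy ys f

  sumBy-cong : ∀ ys {f g : ℕ → ℕ} → (∀ y → f y ≡ g y) → sumBy ys f ≡ sumBy ys g
  sumBy-cong []       f≗g = refl
  sumBy-cong (y ∷ ys) f≗g = cong₂ _+_ (f≗g y) (sumBy-cong ys f≗g)

  sumBy-+ : ∀ ys (f g : ℕ → ℕ) → sumBy ys (λ y → f y + g y) ≡ sumBy ys f + sumBy ys g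
  sumBy-+ []       f g = refl
  sumBy-+ (y ∷ ys) f g = trans (cong (f y + g y +_) (sumBy-+ ys f g)) (interchange (f y) (g y) _ _)
    where
      interchange : ∀ a b c d → a + b + (c + d) ≡ a + c + (b + d)
      interchange = solve-∀

  sumBy-*ˡ : ∀ ys c (f : ℕ → ℕ) → sumBy ys (λ y → c * f y) ≡ c * sumBy ys f
  sumBy-*ˡ []       c f = sym (*-zeroʳ c)
  sumBy-*ˡ (y ∷ ys) c f = trans (cong (c * f y +_) (sumBy-*ˡ ys c f)) (sym (*-distribˡ-+ c (f y) _))

  h-one : ∀ ys → h 1 ys ≡ sumBy ys (λ y → y)
  h-one []       = refl
  h-one (y ∷ ys) = trans (cong₂ _+_ (h-one ys) (*-identityʳ y)) (+-comm _ y)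

  -- Both sides equal h_{n+1}(x ∷ y ∷ zs) - h_{n+1}(zs), expanded with the
  -- recurrence in the two orders of x and y; this drives the symmetry of h.
  h-exchange : ∀ n x y zs →
    y * h n (y ∷ zs) + x * h n (x ∷ y ∷ zs) ≡ x * h n (x ∷ zs) + y * h n (x ∷ y ∷ zs)
  h-exchange zero    x y zs = +-comm (y * 1) (x * 1)
  h-exchange (suc n) x y zs = begin
      y * (H + y * A) + x * ((H + y * A) + x * C)
    ≡⟨ expand x y H A C ⟩
      y * H + y * y * A + x * H + x * (y * A + x * C)
    ≡⟨ cong (λ t → y * H + y * y * A + x * H + x * t) (h-exchange n x y zs) ⟩
      y * H + y * y * A + x * H + x * (x * E + y * C)
    ≡⟨ collect x y H A C E ⟩
      x * (H + x * E) + y * ((H + y * A) + x * C)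
    ∎
    where
      H = h (suc n) zs
      A = h n (y ∷ zs)
      C = h n (x ∷ y ∷ zs)
      E = h n (x ∷ zs)
      expand : ∀ x y H A C →
        y * (H + y * A) + x * ((H + y * A) + x * C) ≡ y * H + y * y * A + x * H + x * (y * A + x * C)
      expand = solve-∀
      collect : ∀ x y H A C E →
        y * H + y * y * A + x * H + x * (x * E + y * C) ≡ x * (H + x * E) + y * ((H + y * A) + x * C)
      collect = solve-∀

  h-swap : ∀ n x y zs → h n (x ∷ y ∷ zs) ≡ h n (y ∷ x ∷ zs)
  h-swap zero    x y zs = refl
  h-swap (suc n) x y zs = begin
      (H + y * h n (y ∷ zs)) + x * h n (x ∷ y ∷ zs)
    ≡⟨ +-assoc H _ _ ⟩
      H + (y * h n (y ∷ zs) + x * h n (x ∷ y ∷ zs))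
    ≡⟨ cong (H +_) (h-exchange n x y zs) ⟩
      H + (x * h n (x ∷ zs) + y * h n (x ∷ y ∷ zs))
    ≡⟨ cong (λ t → H + (x * h n (x ∷ zs) + y * t)) (h-swap n x y zs) ⟩
      H + (x * h n (x ∷ zs) + y * h n (y ∷ x ∷ zs))
    ≡⟨ sym (+-assoc H _ _) ⟩
      (H + x * h n (x ∷ zs)) + y * h n (y ∷ x ∷ zs)
    ∎
    where H = h (suc n) zs

  h-second : ∀ n y x r → h (suc n) (y ∷ x ∷ r) ≡ h (suc n) (y ∷ r) + x * h n (y ∷ x ∷ r)
  h-second n y x r = begin
      h (suc n) (y ∷ x ∷ r)
    ≡⟨ h-swap (suc n) y x r ⟩
      h (suc n) (y ∷ r) + x * h n (x ∷ y ∷ r)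
    ≡⟨ cong (λ t → h (suc n) (y ∷ r) + x * t) (h-swap n x y r) ⟩
      h (suc n) (y ∷ r) + x * h n (y ∷ x ∷ r)
    ∎

  -- D n ys zs = Σ_{y ∈ ys} y · h_n(y ∷ zs).  Since ∂h_{n+1}/∂y = h_n(y ∷ -),
  -- D n xs xs is the Euler operator Σ x_i ∂/∂x_i applied to h_{n+1}(xs).
  D : ℕ → List ℕ → List ℕ → ℕ
  D n ys zs = sumBy ys (λ y → y * h n (y ∷ zs))

  D-zero : ∀ ys zs → D 0 ys zs ≡ h 1 ys
  D-zero ys zs = trans (sumBy-cong ys (λ y → *-identityʳ y)) (sym (h-one ys))

  D-peel : ∀ m x r ys → D (suc m) ys (x ∷ r) ≡ D (suc m) ys r + x * D m ys (x ∷ r)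
  D-peel m x r ys = begin
      sumBy ys (λ y → y * h (suc m) (y ∷ x ∷ r))
    ≡⟨ sumBy-cong ys (λ y → trans (cong (y *_) (h-second m y x r)) (distrib y x _ _)) ⟩
      sumBy ys (λ y → y * h (suc m) (y ∷ r) + x * (y * h m (y ∷ x ∷ r)))
    ≡⟨ sumBy-+ ys _ _ ⟩
      D (suc m) ys r + sumBy ys (λ y → x * (y * h m (y ∷ x ∷ r)))
    ≡⟨ cong (D (suc m) ys r +_) (sumBy-*ˡ ys x _) ⟩
      D (suc m) ys r + x * D m ys (x ∷ r)
    ∎
    where
      distrib : ∀ y x a b → y * (a + x * b) ≡ y * a + x * (y * b)
      distrib = solve-∀

  euler : ∀ n xs → D n xs xs ≡ suc n * h (suc n) xs
  euler n []      = sym (*-zeroʳ (suc n))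
  euler n (x ∷ r) = euler-cons n
    where
      euler-cons : ∀ n → x * h n (x ∷ x ∷ r) + D n r (x ∷ r) ≡ suc n * h (suc n) (x ∷ r)
      euler-cons zero = trans (cong (x * 1 +_) (D-zero r (x ∷ r))) (base-identity x (h 1 r))
        where
          base-identity : ∀ x s → x * 1 + s ≡ 1 * (s + x * 1)
          base-identity = solve-∀
      euler-cons (suc m) = begin
          x * (h (suc m) (x ∷ r) + x * h m (x ∷ x ∷ r)) + D (suc m) r (x ∷ r)
        ≡⟨ cong (x * (h (suc m) (x ∷ r) + x * h m (x ∷ x ∷ r)) +_) (D-peel m x r r) ⟩
          x * (h (suc m) (x ∷ r) + x * h m (x ∷ x ∷ r)) + (D (suc m) r r + x * D m r (x ∷ r))
        ≡⟨ regroup x (h (suc m) (x ∷ r)) (h m (x ∷ x ∷ r)) (D (suc m) r r) (D m r (x ∷ r)) ⟩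
          x * h (suc m) (x ∷ r) + x * (x * h m (x ∷ x ∷ r) + D m r (x ∷ r)) + D (suc m) r r
        ≡⟨ cong₂ (λ s t → x * h (suc m) (x ∷ r) + x * s + t) (euler-cons m) (euler (suc m) r) ⟩
          x * h (suc m) (x ∷ r) + x * (suc m * h (suc m) (x ∷ r)) + suc (suc m) * h (suc (suc m)) r
        ≡⟨ factor x (h (suc m) (x ∷ r)) m (h (suc (suc m)) r) ⟩
          suc (suc m) * (h (suc (suc m)) r + x * h (suc m) (x ∷ r))
        ∎
        where
          regroup : ∀ x a b c d → x * (a + x * b) + (c + x * d) ≡ x * a + x * (x * b + d) + c
          regroup = solve-∀
          factor : ∀ x a m b → x * a + x * ((1 + m) * a) + (2 + m) * b ≡ (2 + m) * (b + x * a)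
          factor = solve-∀

module LogConvexTriples where

  open import Data.Nat using (_+_; _*_; _≤_; _∸_; z≤n)
  open import Data.Nat.Properties
    using (≤-<-connex; <⇒≱; *-mono-<; ≤-total; m+[n∸m]≡n; m≤m+n; *-mono-≤; *-monoʳ-≤; +-mono-≤; *-cancelˡ-≤;
           module ≤-Reasoning)
  open import Data.Nat.Tactic.RingSolver using (solve-∀)
  open import Data.List using ([]; _∷_)
  open import Data.Sum using (inj₁; inj₂)
  open import Relation.Nullary using (contradiction)
  open import Relation.Binary.PropositionalEquality using (_≡_; refl; sym; subst; subst₂)
  open CompleteHomogeneous using (sumBy)

  -- The three-term sequence a, b, c is log-convex.  A record, so that the
  -- terms can be inferred from a proof.
  record LogConvex (a b c : ℕ) : Set where
    constructor log-convex
    field bound : b * b ≤ a * c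
  open LogConvex public

  LogConvex-resp : ∀ {a b c a′ b′ c′} → a ≡ a′ → b ≡ b′ → c ≡ c′ → LogConvex a b c → LogConvex a′ b′ c′
  LogConvex-resp refl refl refl lc = lc

  square-≤-cancel : ∀ a b → a * a ≤ b * b → a ≤ b
  square-≤-cancel a b a²≤b² with ≤-<-connex a b
  ... | inj₁ a≤b = a≤b
  ... | inj₂ b<a = contradiction a²≤b² (<⇒≱ (*-mono-< b<a b<a))

  -- AM–GM:  4ab ≤ (a+b)².  For a ≤ b write b = a + d; then (a+b)² = 4ab + d².
  am-gm-≤ : ∀ {a b} → a ≤ b → 4 * a * b ≤ (a + b) * (a + b)
  am-gm-≤ {a} {b} a≤b = subst (λ t → 4 * a * t ≤ (a + t) * (a + t)) (m+[n∸m]≡n a≤b)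
    (subst (4 * a * (a + d) ≤_) (square-expansion a d) (m≤m+n _ (d * d)))
    where
      d = b ∸ a
      square-expansion : ∀ a d → 4 * a * (a + d) + d * d ≡ (a + (a + d)) * (a + (a + d))
      square-expansion = solve-∀

  am-gm : ∀ a b → 4 * a * b ≤ (a + b) * (a + b)
  am-gm a b with ≤-total a b
  ... | inj₁ a≤b = am-gm-≤ a≤b
  ... | inj₂ b≤a = subst₂ _≤_ (commute₁ b a) (commute₂ b a) (am-gm-≤ b≤a)
    where
      commute₁ : ∀ a b → 4 * a * b ≡ 4 * b * a
      commute₁ = solve-∀
      commute₂ : ∀ a b → (a + b) * (a + b) ≡ (b + a) * (b + a)
      commute₂ = solve-∀

  -- The cross term:  2 b₁ b₂ ≤ a₁ c₂ + a₂ c₁,  since (2 b₁ b₂)² ≤ 4 (a₁c₂)(a₂c₁).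
  LogConvex-cross : ∀ {a₁ b₁ c₁ a₂ b₂ c₂} → LogConvex a₁ b₁ c₁ → LogConvex a₂ b₂ c₂ →
                    2 * (b₁ * b₂) ≤ a₁ * c₂ + a₂ * c₁
  LogConvex-cross {a₁} {b₁} {c₁} {a₂} {b₂} {c₂} (log-convex lc₁) (log-convex lc₂) = square-≤-cancel _ _ (begin
      2 * (b₁ * b₂) * (2 * (b₁ * b₂))  ≡⟨ square-product b₁ b₂ ⟩
      4 * (b₁ * b₁) * (b₂ * b₂)        ≤⟨ *-mono-≤ (*-monoʳ-≤ 4 lc₁) lc₂ ⟩
      4 * (a₁ * c₁) * (a₂ * c₂)        ≡⟨ rearrange a₁ c₁ a₂ c₂ ⟩
      4 * (a₁ * c₂) * (a₂ * c₁)        ≤⟨ am-gm (a₁ * c₂) (a₂ * c₁) ⟩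
      (a₁ * c₂ + a₂ * c₁) * (a₁ * c₂ + a₂ * c₁) ∎)
    where
      open ≤-Reasoning
      square-product : ∀ x y → 2 * (x * y) * (2 * (x * y)) ≡ 4 * (x * x) * (y * y)
      square-product = solve-∀
      rearrange : ∀ a b c d → 4 * (a * b) * (c * d) ≡ 4 * (a * d) * (c * b)
      rearrange = solve-∀

  LogConvex-+ : ∀ {a₁ b₁ c₁ a₂ b₂ c₂} → LogConvex a₁ b₁ c₁ → LogConvex a₂ b₂ c₂ →
                LogConvex (a₁ + a₂) (b₁ + b₂) (c₁ + c₂)
  LogConvex-+ {a₁} {b₁} {c₁} {a₂} {b₂} {c₂} lc₁ lc₂ = log-convex (begin
      (b₁ + b₂) * (b₁ + b₂)                    ≡⟨ expand b₁ b₂ ⟩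
      (b₁ * b₁ + b₂ * b₂) + 2 * (b₁ * b₂)      ≤⟨ +-mono-≤ (+-mono-≤ (bound lc₁) (bound lc₂)) (LogConvex-cross lc₁ lc₂) ⟩
      (a₁ * c₁ + a₂ * c₂) + (a₁ * c₂ + a₂ * c₁) ≡⟨ factor a₁ c₁ a₂ c₂ ⟩
      (a₁ + a₂) * (c₁ + c₂)                    ∎)
    where
      open ≤-Reasoning
      expand : ∀ x y → (x + y) * (x + y) ≡ (x * x + y * y) + 2 * (x * y)
      expand = solve-∀
      factor : ∀ a c a′ c′ → (a * c + a′ * c′) + (a * c′ + a′ * c) ≡ (a + a′) * (c + c′)
      factor = solve-∀

  LogConvex-sumBy : ∀ ys {f g k : ℕ → ℕ} → (∀ y → LogConvex (f y) (g y) (k y)) →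
                    LogConvex (sumBy ys f) (sumBy ys g) (sumBy ys k)
  LogConvex-sumBy []       lc = log-convex z≤n
  LogConvex-sumBy (y ∷ ys) lc = LogConvex-+ (lc y) (LogConvex-sumBy ys lc)

  scale-square : ∀ c x y → c * x * (c * y) ≡ c * c * (x * y)
  scale-square = solve-∀

  LogConvex-scale : ∀ c {a b d} → LogConvex a b d → LogConvex (c * a) (c * b) (c * d)
  LogConvex-scale c {a} {b} {d} (log-convex lc) = log-convex (begin
      c * b * (c * b)  ≡⟨ scale-square c b b ⟩
      c * c * (b * b)  ≤⟨ *-monoʳ-≤ (c * c) lc ⟩
      c * c * (a * d)  ≡⟨ sym (scale-square c a d) ⟩
      c * a * (c * d)  ∎)
    where open ≤-Reasoning

  LogConvex-cancel : ∀ c {a b d} → LogConvex (suc c * a) (suc c * b) (suc c * d) → LogConvex a b d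
  LogConvex-cancel c {a} {b} {d} (log-convex lc) = log-convex (*-cancelˡ-≤ (suc c * suc c) (begin
      suc c * suc c * (b * b)  ≡⟨ sym (scale-square (suc c) b b) ⟩
      suc c * b * (suc c * b)  ≤⟨ lc ⟩
      suc c * a * (suc c * d)  ≡⟨ scale-square (suc c) a d ⟩
      suc c * suc c * (a * d)  ∎))
    where open ≤-Reasoning

module NewtonInequality where

  open import Data.Nat using (zero; _+_; _*_; _≤_)
  open import Data.Nat.Properties using (≤-reflexive; *-identityˡ; *-cancelˡ-≤; module ≤-Reasoning)
  open import Data.Nat.Tactic.RingSolver using (solve-∀)
  open import Data.List using (List; []; _∷_; length)
  open import Relation.Binary.PropositionalEquality
    using (_≡_; refl; sym; trans; cong; module ≡-Reasoning)
  open CompleteHomogeneous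
  open LogConvexTriples

  -- The weights are chosen so that all three obey the same Euler step below.
  lo mid hi : ℕ → List ℕ → ℕ
  lo  n xs = (length xs + n) * suc (length xs + n) * h n xs
  mid n xs = suc n * suc (length xs + n) * h (suc n) xs
  hi  n xs = suc n * suc (suc n) * h (suc (suc n)) xs

  euler-weighted : ∀ n xs c → sumBy xs (λ y → y * (c * h n (y ∷ xs))) ≡ c * (suc n * h (suc n) xs)
  euler-weighted n xs c = begin
      sumBy xs (λ y → y * (c * h n (y ∷ xs)))
    ≡⟨ sumBy-cong xs (λ y → commute y c (h n (y ∷ xs))) ⟩
      sumBy xs (λ y → c * (y * h n (y ∷ xs)))
    ≡⟨ sumBy-*ˡ xs c _ ⟩
      c * D n xs xs
    ≡⟨ cong (c *_) (euler n xs) ⟩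
      c * (suc n * h (suc n) xs)
    ∎
    where
      open ≡-Reasoning
      commute : ∀ y c a → y * (c * a) ≡ c * (y * a)
      commute = solve-∀

  lo-step : ∀ n xs → sumBy xs (λ y → y * lo n (y ∷ xs)) ≡ suc n * lo (suc n) xs
  lo-step n xs = trans (euler-weighted n xs ((suc (length xs) + n) * suc (suc (length xs) + n)))
                       (reweigh (length xs) n (h (suc n) xs))
    where
      reweigh : ∀ m n a → (1 + m + n) * (2 + m + n) * ((1 + n) * a)
                          ≡ (1 + n) * ((m + (1 + n)) * (1 + (m + (1 + n))) * a)
      reweigh = solve-∀

  mid-step : ∀ n xs → sumBy xs (λ y → y * mid n (y ∷ xs)) ≡ suc n * mid (suc n) xs
  mid-step n xs = trans (euler-weighted (suc n) xs (suc n * suc (suc (length xs) + n)))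
                        (reweigh (length xs) n (h (suc (suc n)) xs))
    where
      reweigh : ∀ m n a → (1 + n) * (2 + m + n) * ((2 + n) * a)
                          ≡ (1 + n) * ((2 + n) * (1 + (m + (1 + n))) * a)
      reweigh = solve-∀

  hi-step : ∀ n xs → sumBy xs (λ y → y * hi n (y ∷ xs)) ≡ suc n * hi (suc n) xs
  hi-step n xs = trans (euler-weighted (suc (suc n)) xs (suc n * suc (suc n)))
                       (reweigh n (h (suc (suc (suc n))) xs))
    where
      reweigh : ∀ n a → (1 + n) * (2 + n) * ((3 + n) * a) ≡ (1 + n) * ((2 + n) * (3 + n) * a)
      reweigh = solve-∀

  cauchy-schwarz : ∀ xs → LogConvex (length xs) (sumBy xs (λ y → y)) (sumBy xs (λ y → y * y))
  cauchy-schwarz []       = log-convex (≤-reflexive refl)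
  cauchy-schwarz (x ∷ xs) = LogConvex-+ (log-convex (≤-reflexive (sym (*-identityˡ (x * x))))) (cauchy-schwarz xs)

  two-h₂ : ∀ xs → h 1 xs * h 1 xs + sumBy xs (λ y → y * y) ≡ 2 * h 2 xs
  two-h₂ xs = begin
      s * s + sumBy xs (λ y → y * y)
    ≡⟨ cong (_+ sumBy xs (λ y → y * y)) (trans (cong (s *_) (h-one xs)) (sym (sumBy-*ˡ xs s (λ y → y)))) ⟩
      sumBy xs (λ y → s * y) + sumBy xs (λ y → y * y)
    ≡⟨ sym (sumBy-+ xs _ _) ⟩
      sumBy xs (λ y → s * y + y * y)
    ≡⟨ sumBy-cong xs (λ y → expand y s) ⟩
      D 1 xs xs
    ≡⟨ euler 1 xs ⟩
      2 * h 2 xs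
    ∎
    where
      open ≡-Reasoning
      s = h 1 xs
      expand : ∀ y s → s * y + y * y ≡ y * (s + y * 1)
      expand = solve-∀

  -- Degree 0: the sum of the triples (m², m·h₁, h₁²) and (m, h₁, Σ y²).
  lo-mid-hi-zero : ∀ xs → LogConvex (lo 0 xs) (mid 0 xs) (hi 0 xs)
  lo-mid-hi-zero xs =
    LogConvex-resp (lo-identity m) (mid-identity m (h 1 xs)) (trans (two-h₂ xs) (hi-identity (h 2 xs)))
      (LogConvex-+ (log-convex (≤-reflexive (square-triple m (h 1 xs))))
                   (LogConvex-resp refl (sym (h-one xs)) refl (cauchy-schwarz xs)))
    where
      m = length xs
      square-triple : ∀ m s → m * s * (m * s) ≡ m * m * (s * s)
      square-triple = solve-∀
      lo-identity : ∀ m → m * m + m ≡ (m + 0) * (1 + (m + 0)) * 1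
      lo-identity = solve-∀
      mid-identity : ∀ m s → m * s + s ≡ 1 * (1 + (m + 0)) * s
      mid-identity = solve-∀
      hi-identity : ∀ a → 2 * a ≡ 1 * 2 * a
      hi-identity = solve-∀

  lo-mid-hi : ∀ n xs → LogConvex (lo n xs) (mid n xs) (hi n xs)
  lo-mid-hi zero    xs = lo-mid-hi-zero xs
  lo-mid-hi (suc n) xs =
    LogConvex-cancel n
      (LogConvex-resp (lo-step n xs) (mid-step n xs) (hi-step n xs)
        (LogConvex-sumBy xs (λ y → LogConvex-scale y (lo-mid-hi n (y ∷ xs)))))

  h-log-convex : ∀ n xs →
    suc n * suc (length xs + n) * (h (suc n) xs * h (suc n) xs)
      ≤ (length xs + n) * suc (suc n) * (h n xs * h (suc (suc n)) xs)
  h-log-convex n xs = *-cancelˡ-≤ (suc n * suc (m + n)) (begin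
      suc n * suc (m + n) * (suc n * suc (m + n) * (b * b))
    ≡⟨ mid-square n m b ⟩
      mid n xs * mid n xs
    ≤⟨ bound (lo-mid-hi n xs) ⟩
      lo n xs * hi n xs
    ≡⟨ lo-hi-product n m a c ⟩
      suc n * suc (m + n) * ((m + n) * suc (suc n) * (a * c))
    ∎)
    where
      open ≤-Reasoning
      m = length xs
      a = h n xs
      b = h (suc n) xs
      c = h (suc (suc n)) xs
      mid-square : ∀ n m b → (1 + n) * (1 + (m + n)) * ((1 + n) * (1 + (m + n)) * (b * b))
                             ≡ (1 + n) * (1 + (m + n)) * b * ((1 + n) * (1 + (m + n)) * b)
      mid-square = solve-∀
      lo-hi-product : ∀ n m a c → (m + n) * (1 + (m + n)) * a * ((1 + n) * (2 + n) * c)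
                                  ≡ (1 + n) * (1 + (m + n)) * ((m + n) * (2 + n) * (a * c))
      lo-hi-product = solve-∀

module Stirling where

  open import Data.Nat using (zero; _+_; _*_; _≤_; _<_; s≤s)
  open import Data.Nat.Properties
    using (m<n⇒m<1+n; n<1+n; +-identityʳ; *-zeroʳ; *-identityʳ; +-suc; +-comm; m≤n+m; m+n∸n≡m;
           *-cancelˡ-≤; *-monoʳ-≤; module ≤-Reasoning)
  open import Data.Nat.Tactic.RingSolver using (solve-∀)
  open import Data.Nat.Combinatorics using (_C_; nCk+nC[k+1]≡[n+1]C[k+1]; nC1≡n; nCk≡nC[n∸k])
  open import Data.List using (length; downFrom)
  open import Data.List.Properties using (length-downFrom)
  open import Relation.Binary.PropositionalEquality
    using (_≡_; refl; sym; trans; cong; cong₂; module ≡-Reasoning)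
  open CompleteHomogeneous using (h)
  open NewtonInequality using (h-log-convex)

  S-below-diagonal : ∀ m k → m < k → S m k ≡ 0
  S-below-diagonal zero    (suc k) _         = refl
  S-below-diagonal (suc m) (suc k) (s≤s m<k)
    rewrite S-below-diagonal m (suc k) (m<n⇒m<1+n m<k) | S-below-diagonal m k m<k =
      trans (+-identityʳ _) (*-zeroʳ k)

  S-diagonal : ∀ m → S m m ≡ 1
  S-diagonal zero    = refl
  S-diagonal (suc m) rewrite S-below-diagonal m (suc m) (n<1+n m) | S-diagonal m = cong (_+ 1) (*-zeroʳ m)

  -- S(n+k, k) = h_n(k, k-1, ..., 0): both satisfy the Stirling recurrence.
  S-as-h : ∀ k n → h n (downFrom (suc k)) ≡ S (n + k) k
  S-as-h zero    zero    = refl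
  S-as-h zero    (suc n) = refl
  S-as-h (suc j) zero    = sym (S-diagonal (suc j))
  S-as-h (suc j) (suc m) = begin
      h (suc m) (downFrom (suc j)) + suc j * h m (downFrom (suc (suc j)))
    ≡⟨ cong₂ _+_ (S-as-h j (suc m)) (cong (suc j *_) (S-as-h (suc j) m)) ⟩
      S (suc m + j) j + suc j * S (m + suc j) (suc j)
    ≡⟨ cong (λ t → S t j + suc j * S (m + suc j) (suc j)) (sym (+-suc m j)) ⟩
      S (m + suc j) j + suc j * S (m + suc j) (suc j)
    ≡⟨ +-comm (S (m + suc j) j) _ ⟩
      S (suc m + suc j) (suc j)
    ∎
    where open ≡-Reasoning

  C-absorb : ∀ n k → suc k * (suc n C suc k) ≡ suc n * (n C k)
  C-absorb zero    zero    = refl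
  C-absorb zero    (suc k) = *-zeroʳ (suc (suc k))
  C-absorb (suc n) zero    = trans (+-identityʳ _) (trans (nC1≡n (suc (suc n))) (sym (*-identityʳ (suc (suc n)))))
  C-absorb (suc n) (suc j) = begin
      suc (suc j) * (suc (suc n) C suc (suc j))
    ≡⟨ cong (suc (suc j) *_) (sym (nCk+nC[k+1]≡[n+1]C[k+1] (suc n) (suc j))) ⟩
      suc (suc j) * (A + B)
    ≡⟨ split (suc j) A B ⟩
      A + suc j * A + suc (suc j) * B
    ≡⟨ cong₂ (λ s t → A + s + t) (C-absorb n j) (C-absorb n (suc j)) ⟩
      A + suc n * (n C j) + suc n * (n C suc j)
    ≡⟨ factor A (suc n) (n C j) (n C suc j) ⟩
      A + suc n * (n C j + n C suc j)
    ≡⟨ cong (λ t → A + suc n * t) (nCk+nC[k+1]≡[n+1]C[k+1] n j) ⟩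
      A + suc n * A
    ∎
    where
      open ≡-Reasoning
      A = suc n C suc j
      B = suc n C suc (suc j)
      split : ∀ j a b → (1 + j) * (a + b) ≡ a + j * a + (1 + j) * b
      split = solve-∀
      factor : ∀ a m c d → a + m * c + m * d ≡ a + m * (c + d)
      factor = solve-∀

  C-sym : ∀ m k → (m + k) C k ≡ (m + k) C m
  C-sym m k = trans (nCk≡nC[n∸k] (m≤n+m k m)) (cong ((m + k) C_) (m+n∸n≡m m k))

  C-step : ∀ ℓ k → suc ℓ * ((suc ℓ + k) C k) ≡ suc (ℓ + k) * ((ℓ + k) C k)
  C-step ℓ k = begin
      suc ℓ * ((suc ℓ + k) C k)     ≡⟨ cong (suc ℓ *_) (C-sym (suc ℓ) k) ⟩
      suc ℓ * (suc (ℓ + k) C suc ℓ) ≡⟨ C-absorb (ℓ + k) ℓ ⟩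
      suc (ℓ + k) * ((ℓ + k) C ℓ)   ≡⟨ cong (suc (ℓ + k) *_) (sym (C-sym ℓ k)) ⟩
      suc (ℓ + k) * ((ℓ + k) C k)   ∎
    where open ≡-Reasoning

  stirling-newton : ∀ k ℓ →
    suc ℓ * suc (suc k + ℓ) * (S (suc ℓ + k) k * S (suc ℓ + k) k)
      ≤ (suc k + ℓ) * suc (suc ℓ) * (S (ℓ + k) k * S (suc (suc ℓ) + k) k)
  stirling-newton k ℓ =
    instantiate (length-downFrom (suc k)) (S-as-h k ℓ) (S-as-h k (suc ℓ)) (S-as-h k (suc (suc ℓ)))
    where
      xs = downFrom (suc k)
      instantiate : ∀ {m a b c} → length xs ≡ m → h ℓ xs ≡ a → h (suc ℓ) xs ≡ b → h (suc (suc ℓ)) xs ≡ c →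
                    suc ℓ * suc (m + ℓ) * (b * b) ≤ (m + ℓ) * suc (suc ℓ) * (a * c)
      instantiate refl refl refl refl = h-log-convex ℓ xs

  stirling-ratio-cleared : ∀ k ℓ →
    S (suc ℓ + k) k * S (suc ℓ + k) k * (((suc (suc ℓ) + k) C k) * ((ℓ + k) C k))
      ≤ S (suc (suc ℓ) + k) k * S (ℓ + k) k * (((suc ℓ + k) C k) * ((suc ℓ + k) C k))
  stirling-ratio-cleared k ℓ = *-cancelˡ-≤ (suc (suc ℓ) * suc (ℓ + k)) (begin
      suc (suc ℓ) * suc (ℓ + k) * (S₁ * S₁ * (C₂ * C₀))
    ≡⟨ pair-weights (suc (suc ℓ)) (suc (ℓ + k)) S₁ C₂ C₀ ⟩
      S₁ * S₁ * ((suc (suc ℓ) * C₂) * (suc (ℓ + k) * C₀))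
    ≡⟨ cong₂ (λ u v → S₁ * S₁ * (u * v)) (C-step (suc ℓ) k) (sym (C-step ℓ k)) ⟩
      S₁ * S₁ * (suc (suc ℓ + k) * C₁ * (suc ℓ * C₁))
    ≡⟨ extract-C₁ ℓ k S₁ C₁ ⟩
      C₁ * C₁ * (suc ℓ * suc (suc k + ℓ) * (S₁ * S₁))
    ≤⟨ *-monoʳ-≤ (C₁ * C₁) (stirling-newton k ℓ) ⟩
      C₁ * C₁ * ((suc k + ℓ) * suc (suc ℓ) * (S₀ * S₂))
    ≡⟨ restore ℓ k S₀ S₂ C₁ ⟩
      suc (suc ℓ) * suc (ℓ + k) * (S₂ * S₀ * (C₁ * C₁))
    ∎)
    where
      open ≤-Reasoning
      S₀ = S (ℓ + k) k
      S₁ = S (suc ℓ + k) k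
      S₂ = S (suc (suc ℓ) + k) k
      C₀ = (ℓ + k) C k
      C₁ = (suc ℓ + k) C k
      C₂ = (suc (suc ℓ) + k) C k
      pair-weights : ∀ p q s c c′ → p * q * (s * s * (c * c′)) ≡ s * s * ((p * c) * (q * c′))
      pair-weights = solve-∀
      extract-C₁ : ∀ ℓ k s c → s * s * ((2 + ℓ + k) * c * ((1 + ℓ) * c))
                               ≡ c * c * ((1 + ℓ) * (2 + k + ℓ) * (s * s))
      extract-C₁ = solve-∀
      restore : ∀ ℓ k s₀ s₂ c → c * c * ((1 + k + ℓ) * (2 + ℓ) * (s₀ * s₂))
                                ≡ (2 + ℓ) * (1 + (ℓ + k)) * (s₂ * s₀ * (c * c))
      restore = solve-∀

module Fractions where

  open import Data.Nat as ℕ using (NonZero)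
  open import Data.Integer as ℤ using (+_; +≤+)
  open import Data.Integer.Properties using (pos-*)
  open import Data.Rational using (_/_; _*_; _≤_; toℚᵘ)
  open import Data.Rational.Properties using (toℚᵘ-cancel-≤; toℚᵘ-homo-*; toℚᵘ-fromℚᵘ)
  import Data.Rational.Unnormalised as ℚᵘ
  import Data.Rational.Unnormalised.Properties as ℚᵘ
  open import Relation.Binary.PropositionalEquality using (_≡_; trans; cong; subst₂)

  toℚᵘ-/ : ∀ n d .{{_ : NonZero d}} → toℚᵘ (+ n / d) ℚᵘ.≃ (+ n ℚᵘ./ d)
  toℚᵘ-/ n (suc d) = toℚᵘ-fromℚᵘ (ℚᵘ.mkℚᵘ (+ n) d)

  pos-*-* : ∀ a b c → + (a ℕ.* b ℕ.* c) ≡ (+ a ℤ.* + b) ℤ.* + c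
  pos-*-* a b c = trans (pos-* (a ℕ.* b) c) (cong (ℤ._* + c) (pos-* a b))

  -- The same comparison for unnormalised fractions, where it is definitional.
  ᵘ-product-≤ : ∀ a₁ a₂ b₁ b₂ c₁ c₂ d₁ d₂
                  .{{_ : NonZero c₁}} .{{_ : NonZero c₂}} .{{_ : NonZero d₁}} .{{_ : NonZero d₂}} →
                a₁ ℕ.* a₂ ℕ.* (d₁ ℕ.* d₂) ℕ.≤ b₁ ℕ.* b₂ ℕ.* (c₁ ℕ.* c₂) →
                (+ a₁ ℚᵘ./ c₁) ℚᵘ.* (+ a₂ ℚᵘ./ c₂) ℚᵘ.≤ (+ b₁ ℚᵘ./ d₁) ℚᵘ.* (+ b₂ ℚᵘ./ d₂)
  ᵘ-product-≤ a₁ a₂ b₁ b₂ (suc c₁) (suc c₂) (suc d₁) (suc d₂) le =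
    ℚᵘ.*≤* (subst₂ ℤ._≤_ (pos-*-* a₁ a₂ _) (pos-*-* b₁ b₂ _) (+≤+ le))

  frac-product-≤ : ∀ a₁ a₂ b₁ b₂ c₁ c₂ d₁ d₂
                     .{{_ : NonZero c₁}} .{{_ : NonZero c₂}} .{{_ : NonZero d₁}} .{{_ : NonZero d₂}} →
                   a₁ ℕ.* a₂ ℕ.* (d₁ ℕ.* d₂) ℕ.≤ b₁ ℕ.* b₂ ℕ.* (c₁ ℕ.* c₂) →
                   (+ a₁ / c₁) * (+ a₂ / c₂) ≤ (+ b₁ / d₁) * (+ b₂ / d₂)
  frac-product-≤ a₁ a₂ b₁ b₂ c₁ c₂ d₁ d₂ le =
    toℚᵘ-cancel-≤ (ℚᵘ.≤-respˡ-≃ (ℚᵘ.≃-sym lhs) (ℚᵘ.≤-respʳ-≃ (ℚᵘ.≃-sym rhs)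
      (ᵘ-product-≤ a₁ a₂ b₁ b₂ c₁ c₂ d₁ d₂ le)))
    where
      lhs = ℚᵘ.≃-trans (toℚᵘ-homo-* (+ a₁ / c₁) (+ a₂ / c₂)) (ℚᵘ.*-cong (toℚᵘ-/ a₁ c₁) (toℚᵘ-/ a₂ c₂))
      rhs = ℚᵘ.≃-trans (toℚᵘ-homo-* (+ b₁ / d₁) (+ b₂ / d₂)) (ℚᵘ.*-cong (toℚᵘ-/ b₁ d₁) (toℚᵘ-/ b₂ d₂))

open import Data.Nat using (_+_; >-nonZero)
open import Data.Nat.Combinatorics using (_C_)
open import Data.Rational using (_*_; _≤_)

corollary3p1 : (k ℓ : ℕ) →
    ratio (suc ℓ) k * ratio (suc ℓ) k ≤ ratio (suc (suc ℓ)) k * ratio ℓ k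
corollary3p1 k ℓ =
  Fractions.frac-product-≤ S₁ S₁ S₂ S₀ C₁ C₁ C₂ C₀ (Stirling.stirling-ratio-cleared k ℓ)
  where
    instance
      C₀-nonZero = >-nonZero (binom-pos ℓ k)
      C₁-nonZero = >-nonZero (binom-pos (suc ℓ) k)
      C₂-nonZero = >-nonZero (binom-pos (suc (suc ℓ)) k)
    S₀ = S (ℓ + k) k
    S₁ = S (suc ℓ + k) k
    S₂ = S (suc (suc ℓ) + k) k
    C₀ = (ℓ + k) C k
    C₁ = (suc ℓ + k) C k
    C₂ = (suc (suc ℓ) + k) C k
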